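{- Let $V\subseteq\{0,1\}^n=\mathbb{F}_2^n$ be a linear subspace and let $c=n-\dim(V)$. For every integer $t$ with $1\leq t\leq\ln(2)\,c$, \[ |(V^\perp)_t|\leq\Bigl(\frac{2e\ln(2)\,c}{t}\Bigr)^t\quad\text{and}\quad|(V^\perp)_{n-t}|\leq\Bigl(\frac{2e\ln(2)\,c}{t}\Bigr)^t. \]
   Context: $V^\perp=\{y\in\mathbb{F}_2^n : y\cdot x=0 \text{ for all } x\in V\}$ with $y\cdot x=\sum_i y_ix_i$ over $\mathbb{F}_2$. For $A\subseteq\{0,1\}^n$ and an integer $t$, $A_t$ denotes the set of elements of $A$ with Hamming weight $t$. -}

module Defs where

open import Data.Bool using (Bool; true; false; _xor_; _∧_)
open import Data.Nat using (ℕ; zero; suc)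
import Data.Nat as ℕ
open import Data.Integer using (+_)
open import Data.Rational using (ℚ; _/_; _+_; _*_; _≤_; 0ℚ; 1ℚ; ½)
open import Data.Vec using (Vec; []; _∷_; replicate; zipWith; foldr)
open import Data.List using (List; []; _∷_; map; filter; length; concatMap)
open import Data.List.Relation.Unary.All using (All; all?)
open import Data.Product using (∃; _×_)
open import Relation.Binary.PropositionalEquality using (_≡_)
import Data.Bool.Properties as BoolP
import Data.Nat.Properties as NatP
open import Relation.Nullary using (Dec; _×-dec_)

-- The vector space F₂ⁿ = {0,1}ⁿ, with Bool as F₂ (false = 0, true = 1).

F2^ : ℕ → Set
F2^ n = Vec Bool n

zeroV : ∀ {n} → F2^ n
zeroV = replicate _ false

_⊕_ : ∀ {n} → F2^ n → F2^ n → F2^ n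
_⊕_ = zipWith _xor_

_·ᵥ_ : ∀ {n} → Bool → F2^ n → F2^ n
a ·ᵥ x = Data.Vec.map (a ∧_) x

dot : ∀ {n} → F2^ n → F2^ n → Bool
dot y x = foldr _ _xor_ false (zipWith _∧_ y x)

weight : ∀ {n} → F2^ n → ℕ
weight [] = 0
weight (true ∷ x) = suc (weight x)
weight (false ∷ x) = weight x

allVecs : (n : ℕ) → List (F2^ n)
allVecs zero = [] ∷ []
allVecs (suc n) = concatMap (λ x → (false ∷ x) ∷ (true ∷ x) ∷ []) (allVecs n)

lincomb : ∀ {n k} → F2^ k → Vec (F2^ n) k → F2^ n
lincomb [] [] = zeroV
lincomb (a ∷ as) (v ∷ vs) = (a ·ᵥ v) ⊕ lincomb as vs

-- the subspace spanned by b, listed as all linear combinations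
span : ∀ {n k} → Vec (F2^ n) k → List (F2^ n)
span {k = k} b = map (λ a → lincomb a b) (allVecs k)

LinIndep : ∀ {n k} → Vec (F2^ n) k → Set
LinIndep {n} {k} b = ∀ (a : F2^ k) → lincomb a b ≡ zeroV → a ≡ zeroV

-- A subspace V of F₂ⁿ with dim V = k, given by a basis b.
-- (Every subspace arises in this way.)

InPerp : ∀ {n} → List (F2^ n) → F2^ n → Set
InPerp V y = All (λ x → dot y x ≡ false) V

inPerp? : ∀ {n} (V : List (F2^ n)) (y : F2^ n) → Dec (InPerp V y)
inPerp? V y = all? (λ x → dot y x BoolP.≟ false) V

perpWeightCount : ∀ {n} → List (F2^ n) → ℕ → ℕ
perpWeightCount {n} V w =
  length (filter (λ y → inPerp? V y ×-dec (weight y NatP.≟ w)) (allVecs n))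

-- Rationals and the real constants ln 2 and e via increasing sequences
-- of rational partial sums.

fromℕ : ℕ → ℚ
fromℕ m = + m / 1

-- 1/m for m ≥ 1 (value at 0 is irrelevant; only used with m ≥ 1)
invℕ : ℕ → ℚ
invℕ zero = 0ℚ
invℕ (suc m) = + 1 / suc m

_^ℚ_ : ℚ → ℕ → ℚ
q ^ℚ zero = 1ℚ
q ^ℚ suc m = q * (q ^ℚ m)

-- ln 2 = Σ_{k≥1} 1/(k·2ᵏ); lnTwo N = Σ_{k=1}^{N} 1/(k·2ᵏ)
lnTwo : ℕ → ℚ
lnTwo zero = 0ℚ
lnTwo (suc N) = lnTwo N + (invℕ (suc N) * (½ ^ℚ suc N))

eTerm : ℕ → ℚ
eTerm zero = 1ℚ
eTerm (suc k) = eTerm k * invℕ (suc k)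

eSeq : ℕ → ℚ
eSeq zero = 1ℚ
eSeq (suc N) = eSeq N + eTerm (suc N)

-- q ≤ lim_N s N  for a nondecreasing convergent rational sequence s
-- (equivalently q ≤ sup_N s N): for every ε = 1/(m+1) some term is ≥ q - ε.
_≤lim_ : ℚ → (ℕ → ℚ) → Set
q ≤lim s = ∀ (m : ℕ) → ∃ λ N → q ≤ s N + invℕ (suc m)

module Submission where

-- We bound |(V⟂)_t| and |(V⟂)_{n-t}|
-- by (κ c / t)^t with κ = 32/9 = 2·eSeq 3·lnTwo 3, one term of the sequence increasing to 2e ln 2;
-- a bound by one term is a bound by the limit, in the sense ≤lim of the statement.

open import Defs

module F₂Vectors where
  open import Data.Bool using (true; false; _xor_; _∧_)
  open import Data.Bool.Properties
    using (xor-∧-commutativeRing; xor-identityˡ; xor-identityʳ; xor-same; ∧-identityʳ; ∧-zeroʳ;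
           ∧-distribˡ-xor; ∧-distribʳ-xor)
  open import Data.Nat using (ℕ; suc)
  open import Data.Vec using (Vec; []; _∷_; map; head)
  open import Data.Vec.Properties using (zipWith-identityˡ; zipWith-identityʳ; map-id)
  open import Algebra.Bundles using (CommutativeRing)
  open import Relation.Binary.PropositionalEquality using (_≡_; refl; sym; trans; cong; cong₂; module ≡-Reasoning)

  private
    variable
      m n k : ℕ

  xor-interchange : ∀ a b c d → (a xor b) xor (c xor d) ≡ (a xor c) xor (b xor d)
  xor-interchange = interchange
    where open import Algebra.Properties.CommutativeSemigroup
                        (CommutativeRing.+-commutativeSemigroup xor-∧-commutativeRing)

  ⊕-identityˡ : (v : F2^ n) → zeroV ⊕ v ≡ v
  ⊕-identityˡ = zipWith-identityˡ xor-identityˡ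

  ⊕-identityʳ : (v : F2^ n) → v ⊕ zeroV ≡ v
  ⊕-identityʳ = zipWith-identityʳ xor-identityʳ

  ⊕-interchange : (v w x y : F2^ n) → (v ⊕ w) ⊕ (x ⊕ y) ≡ (v ⊕ x) ⊕ (w ⊕ y)
  ⊕-interchange []      []      []      []      = refl
  ⊕-interchange (a ∷ v) (b ∷ w) (c ∷ x) (d ∷ y) = cong₂ _∷_ (xor-interchange a b c d) (⊕-interchange v w x y)

  ·ᵥ-zero : (v : F2^ n) → false ·ᵥ v ≡ zeroV
  ·ᵥ-zero []      = refl
  ·ᵥ-zero (_ ∷ v) = cong (false ∷_) (·ᵥ-zero v)

  ·ᵥ-one : (v : F2^ n) → true ·ᵥ v ≡ v
  ·ᵥ-one = map-id

  ·ᵥ-distribʳ : ∀ a b (v : F2^ n) → (a xor b) ·ᵥ v ≡ (a ·ᵥ v) ⊕ (b ·ᵥ v)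
  ·ᵥ-distribʳ a b []      = refl
  ·ᵥ-distribʳ a b (c ∷ v) = cong₂ _∷_ (∧-distribʳ-xor c a b) (·ᵥ-distribʳ a b v)

  -- A map F₂ᵐ → F₂ⁿ preserving 0 and ⊕ is linear; over F₂ this already gives compatibility with scalars.
  record Linear (f : F2^ m → F2^ n) : Set where
    field
      preserves-zero : f zeroV ≡ zeroV
      preserves-⊕    : ∀ x y → f (x ⊕ y) ≡ f x ⊕ f y

    preserves-· : ∀ a x → f (a ·ᵥ x) ≡ a ·ᵥ f x
    preserves-· false x = trans (cong f (·ᵥ-zero x)) (trans preserves-zero (sym (·ᵥ-zero (f x))))
    preserves-· true  x = trans (cong f (·ᵥ-one x)) (sym (·ᵥ-one (f x)))

  open Linear

  lincomb-map : {f : F2^ m → F2^ n} → Linear f → (a : F2^ k) (bs : Vec (F2^ m) k) →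
                lincomb a (map f bs) ≡ f (lincomb a bs)
  lincomb-map L []       []       = sym (preserves-zero L)
  lincomb-map {f = f} L (a ∷ as) (v ∷ vs) = begin
    (a ·ᵥ f v) ⊕ lincomb as (map f vs) ≡⟨ cong₂ _⊕_ (sym (preserves-· L a v)) (lincomb-map L as vs) ⟩
    f (a ·ᵥ v) ⊕ f (lincomb as vs)     ≡⟨ sym (preserves-⊕ L (a ·ᵥ v) (lincomb as vs)) ⟩
    f ((a ·ᵥ v) ⊕ lincomb as vs)       ∎
    where open ≡-Reasoning

  lincomb-skip : ∀ v (a : F2^ k) (b : Vec (F2^ n) k) → lincomb (false ∷ a) (v ∷ b) ≡ lincomb a b
  lincomb-skip v a b = trans (cong (_⊕ lincomb a b) (·ᵥ-zero v)) (⊕-identityˡ (lincomb a b))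

  lincomb-zero : (b : Vec (F2^ n) k) → lincomb zeroV b ≡ zeroV
  lincomb-zero []      = refl
  lincomb-zero (v ∷ b) = trans (lincomb-skip v zeroV b) (lincomb-zero b)

  lincomb-unit : ∀ v (b : Vec (F2^ n) k) → lincomb (true ∷ zeroV) (v ∷ b) ≡ v
  lincomb-unit v b = trans (cong₂ _⊕_ (·ᵥ-one v) (lincomb-zero b)) (⊕-identityʳ v)

  zero-extension-linear : Linear {n} (false ∷_)
  zero-extension-linear = record { preserves-zero = refl ; preserves-⊕ = λ _ _ → refl }

  -- Row reduction against a pivot row (1, u): remove γ·(1, u) from the row (γ, w), dropping the
  -- first coordinate, which becomes 0.
  reduce : F2^ n → F2^ (suc n) → F2^ n
  reduce u (γ ∷ w) = (γ ·ᵥ u) ⊕ w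

  reduce-linear : (u : F2^ n) → Linear (reduce u)
  reduce-linear u = record
    { preserves-zero = trans (cong (_⊕ zeroV) (·ᵥ-zero u)) (⊕-identityˡ zeroV)
    ; preserves-⊕    = λ { (x ∷ xs) (y ∷ ys) →
        trans (cong (_⊕ (xs ⊕ ys)) (·ᵥ-distribʳ x y u)) (⊕-interchange (x ·ᵥ u) (y ·ᵥ u) xs ys) }
    }

  clear-pivot : (u : F2^ n) (x : F2^ (suc n)) → (head x ·ᵥ (true ∷ u)) ⊕ x ≡ false ∷ reduce u x
  clear-pivot u (h ∷ w) = cong (_∷ reduce u (h ∷ w)) (trans (cong (_xor h) (∧-identityʳ h)) (xor-same h))

  dot-zeroʳ : (y : F2^ n) → dot y zeroV ≡ false
  dot-zeroʳ []      = refl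
  dot-zeroʳ (c ∷ y) = cong₂ _xor_ (∧-zeroʳ c) (dot-zeroʳ y)

  dot-⊕ʳ : (y v w : F2^ n) → dot y (v ⊕ w) ≡ dot y v xor dot y w
  dot-⊕ʳ []      []      []      = refl
  dot-⊕ʳ (c ∷ y) (a ∷ v) (b ∷ w) = begin
    (c ∧ (a xor b)) xor dot y (v ⊕ w)                ≡⟨ cong₂ _xor_ (∧-distribˡ-xor c a b) (dot-⊕ʳ y v w) ⟩
    ((c ∧ a) xor (c ∧ b)) xor (dot y v xor dot y w)  ≡⟨ xor-interchange (c ∧ a) (c ∧ b) (dot y v) (dot y w) ⟩
    ((c ∧ a) xor dot y v) xor ((c ∧ b) xor dot y w)  ∎
    where open ≡-Reasoning

  dot-·ʳ : ∀ (y : F2^ n) a v → dot y (a ·ᵥ v) ≡ a ∧ dot y v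
  dot-·ʳ y false v = trans (cong (dot y) (·ᵥ-zero v)) (dot-zeroʳ y)
  dot-·ʳ y true  v = cong (dot y) (·ᵥ-one v)

  dot-zero-head : ∀ a (y v : F2^ n) → dot (a ∷ y) (false ∷ v) ≡ dot y v
  dot-zero-head a y v = cong (_xor dot y v) (∧-zeroʳ a)

module Counting where
  open import Data.Bool using (false; true)
  open import Data.Nat using (ℕ; suc; _+_; _≤_; z≤n; s≤s)
  open import Data.Nat.Properties using (+-suc; m≤n⇒m≤1+n; ≤-trans; ≤-reflexive)
  open import Data.List using ([]; _∷_; filter; length; concatMap)
  open import Data.List.Relation.Unary.All using (universal)
  open import Data.List.Properties using (filter-none)
  open import Data.List.Relation.Binary.Sublist.Propositional using (⊆-refl)
  open import Data.List.Relation.Binary.Sublist.Propositional.Properties using (filter⁺; length-mono-≤)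
  open import Data.Vec using (_∷_)
  open import Data.Empty using (⊥-elim)
  open import Relation.Unary using (Pred; Decidable)
  open import Relation.Nullary using (yes; no; ¬_)
  open import Relation.Binary.PropositionalEquality using (_≡_; refl; sym; trans; cong)

  private
    variable
      n : ℕ

  #⟨_⟩ : ∀ {ℓ} {P : Pred (F2^ n) ℓ} → Decidable P → ℕ
  #⟨_⟩ {n} P? = length (filter P? (allVecs n))

  module _ {ℓ₁ ℓ₂ ℓ₃} {A : Set} {P : Pred A ℓ₁} {Q : Pred A ℓ₂} {R : Pred A ℓ₃}
           (P? : Decidable P) (Q? : Decidable Q) (R? : Decidable R) where

    filter-disjoint : (∀ {x} → P x → R x) → (∀ {x} → Q x → R x) → (∀ {x} → P x → ¬ Q x) →
                      ∀ xs → length (filter P? xs) + length (filter Q? xs) ≤ length (filter R? xs)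
    filter-disjoint P⊆R Q⊆R P∩Q=∅ []       = z≤n
    filter-disjoint P⊆R Q⊆R P∩Q=∅ (x ∷ xs) with P? x | Q? x | R? x
    ... | yes p | yes q | _     = ⊥-elim (P∩Q=∅ p q)
    ... | yes p | no _  | no ¬r = ⊥-elim (¬r (P⊆R p))
    ... | no _  | yes q | no ¬r = ⊥-elim (¬r (Q⊆R q))
    ... | yes _ | no _  | yes _ = s≤s (filter-disjoint P⊆R Q⊆R P∩Q=∅ xs)
    ... | no _  | yes _ | yes _ =
      ≤-trans (≤-reflexive (+-suc _ _)) (s≤s (filter-disjoint P⊆R Q⊆R P∩Q=∅ xs))
    ... | no _  | no _  | yes _ = m≤n⇒m≤1+n (filter-disjoint P⊆R Q⊆R P∩Q=∅ xs)
    ... | no _  | no _  | no _  = filter-disjoint P⊆R Q⊆R P∩Q=∅ xs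

  module _ {ℓ₁ ℓ₂} {P : Pred (F2^ n) ℓ₁} {Q : Pred (F2^ n) ℓ₂} (P? : Decidable P) (Q? : Decidable Q) where

    #-mono : (∀ {y} → P y → Q y) → #⟨ P? ⟩ ≤ #⟨ Q? ⟩
    #-mono P⊆Q = length-mono-≤ (filter⁺ P? Q? (λ { refl → P⊆Q }) (⊆-refl {x = allVecs n}))

    #-disjoint : ∀ {ℓ₃} {R : Pred (F2^ n) ℓ₃} (R? : Decidable R) →
                 (∀ {y} → P y → R y) → (∀ {y} → Q y → R y) → (∀ {y} → P y → ¬ Q y) →
                 #⟨ P? ⟩ + #⟨ Q? ⟩ ≤ #⟨ R? ⟩
    #-disjoint R? P⊆R Q⊆R P∩Q=∅ = filter-disjoint P? Q? R? P⊆R Q⊆R P∩Q=∅ (allVecs n)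

  #-none : ∀ {ℓ} {P : Pred (F2^ n) ℓ} (P? : Decidable P) → (∀ {y} → ¬ P y) → #⟨ P? ⟩ ≡ 0
  #-none {n} P? empty = cong length (filter-none P? (universal (λ _ → empty) (allVecs n)))

  #-split : ∀ {ℓ} {P : Pred (F2^ (suc n)) ℓ} (P? : Decidable P) →
            #⟨ P? ⟩ ≡ #⟨ (λ y → P? (false ∷ y)) ⟩ + #⟨ (λ y → P? (true ∷ y)) ⟩
  #-split {n} P? = split (allVecs n)
    where
    split : ∀ xs → length (filter P? (concatMap (λ x → (false ∷ x) ∷ (true ∷ x) ∷ []) xs))
                 ≡ length (filter (λ y → P? (false ∷ y)) xs) + length (filter (λ y → P? (true ∷ y)) xs)
    split []       = refl
    split (x ∷ xs) with P? (false ∷ x)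
    split (x ∷ xs) | yes _ with P? (true ∷ x)
    ... | yes _ = cong suc (trans (cong suc (split xs)) (sym (+-suc _ _)))
    ... | no _  = cong suc (split xs)
    split (x ∷ xs) | no _ with P? (true ∷ x)
    ... | yes _ = trans (cong suc (split xs)) (sym (+-suc _ _))
    ... | no _  = split xs

module Elimination where
  open F₂Vectors
  open import Data.Bool using (true; false; _xor_; _∧_)
  open import Data.Bool.Properties using (∧-comm)
  open import Data.Nat using (ℕ; suc)
  open import Data.Vec using (Vec; []; _∷_; map; head)
  open import Data.Vec.Properties using (∷-injectiveˡ; ∷-injectiveʳ)
  open import Data.Vec.Relation.Unary.All using (All; []; _∷_)
  import Data.Vec.Relation.Unary.All as All
  open import Data.Vec.Relation.Unary.All.Properties using (map⁺; map⁻)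
  open import Data.Product using (∃; _×_; _,_)
  open import Relation.Binary.PropositionalEquality
    using (_≡_; refl; sym; trans; cong; cong₂; subst; module ≡-Reasoning)

  private
    variable
      n k : ℕ

  _⟂_ : F2^ n → Vec (F2^ n) k → Set
  y ⟂ b = All (λ v → dot y v ≡ false) b

  -- Combinations of R, with a 0 prepended, are combinations of b, and nonzero ones lift to nonzero ones.
  -- This is what transfers linear independence from b to R.
  Lifts : Vec (F2^ (suc n)) (suc k) → Vec (F2^ n) k → Set
  Lifts b R = ∀ a → ∃ λ a' → lincomb a' b ≡ false ∷ lincomb a R × (a' ≡ zeroV → a ≡ zeroV)

  lifts-indep : {b : Vec (F2^ (suc n)) (suc k)} {R : Vec (F2^ n) k} → Lifts b R → LinIndep b → LinIndep R
  lifts-indep lifts indep a combination≡0 with lifts a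
  ... | a' , lift , nonzero = nonzero (indep a' (trans lift (cong (false ∷_) combination≡0)))

  zero-column-indep : (T : Vec (F2^ n) k) → LinIndep (map (false ∷_) T) → LinIndep T
  zero-column-indep T indep a combination≡0 =
    indep a (trans (lincomb-map zero-extension-linear a T) (cong (false ∷_) combination≡0))

  zero-column-⟂ : ∀ a (y : F2^ n) (T : Vec (F2^ n) k) → (a ∷ y) ⟂ map (false ∷_) T → y ⟂ T
  zero-column-⟂ a y T ⟂T = All.map (λ {v} → subst (_≡ false) (dot-zero-head a y v)) (map⁻ ⟂T)

  -- One step of Gaussian elimination on the first coordinate of a family b ⊆ F₂¹⁺ⁿ: either every vector
  -- has first coordinate 0, or some vector (1, u) is a pivot, the others reduce to a family R ⊆ F₂ⁿ, and
  -- for y ⟂ b the first coordinate of y is determined by the rest of y.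
  data FirstColumn : Vec (F2^ (suc n)) k → Set where
    zero-column : (T : Vec (F2^ n) k) → FirstColumn (map (false ∷_) T)
    pivot       : {b : Vec (F2^ (suc n)) (suc k)} (u : F2^ n) (R : Vec (F2^ n) k) → Lifts b R →
                  (∀ a y → (a ∷ y) ⟂ b → y ⟂ R × a ≡ dot y u) → FirstColumn b

  private
    pivot-equation : ∀ a d → (a ∧ true) xor d ≡ false → a ≡ d
    pivot-equation false false _ = refl
    pivot-equation true  true  _ = refl
    pivot-equation false true  ()
    pivot-equation true  false ()

    reduce-⟂ : ∀ a (y u : F2^ n) → a ≡ dot y u → ∀ v → dot (a ∷ y) v ≡ false → dot y (reduce u v) ≡ false
    reduce-⟂ a y u a≡yu (γ ∷ w) ⟂v = begin
      dot y ((γ ·ᵥ u) ⊕ w)        ≡⟨ dot-⊕ʳ y (γ ·ᵥ u) w ⟩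
      dot y (γ ·ᵥ u) xor dot y w  ≡⟨ cong (_xor dot y w) (dot-·ʳ y γ u) ⟩
      (γ ∧ dot y u) xor dot y w   ≡⟨ cong (λ d → (γ ∧ d) xor dot y w) (sym a≡yu) ⟩
      (γ ∧ a) xor dot y w         ≡⟨ cong (_xor dot y w) (∧-comm γ a) ⟩
      (a ∧ γ) xor dot y w         ≡⟨ ⟂v ⟩
      false                       ∎
      where open ≡-Reasoning

  firstColumn : (b : Vec (F2^ (suc n)) k) → FirstColumn b
  firstColumn []                 = zero-column []
  firstColumn ((true ∷ u) ∷ bs)  = pivot u (map (reduce u) bs) lifts orth
    where
    lifts : Lifts ((true ∷ u) ∷ bs) (map (reduce u) bs)
    lifts a = (head x ∷ a) , lift , ∷-injectiveʳ
      where
      x = lincomb a bs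
      lift : (head x ·ᵥ (true ∷ u)) ⊕ x ≡ false ∷ lincomb a (map (reduce u) bs)
      lift = trans (clear-pivot u x) (cong (false ∷_) (sym (lincomb-map (reduce-linear u) a bs)))
    orth : ∀ a y → (a ∷ y) ⟂ ((true ∷ u) ∷ bs) → y ⟂ map (reduce u) bs × a ≡ dot y u
    orth a y (⟂pivot ∷ ⟂bs) = map⁺ (All.map (λ {v} → reduce-⟂ a y u a≡yu v) ⟂bs) , a≡yu
      where a≡yu = pivot-equation a (dot y u) ⟂pivot
  firstColumn ((false ∷ v) ∷ bs) with firstColumn bs
  ... | zero-column T         = zero-column (v ∷ T)
  ... | pivot u R lifts orth  = pivot u (v ∷ R) lifts′ orth′
    where
    lifts′ : Lifts ((false ∷ v) ∷ bs) (v ∷ R)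
    lifts′ (α ∷ a) with lifts a
    ... | a' , lift , nonzero =
      (α ∷ a') , cong₂ _⊕_ (sym (preserves-· zero-extension-linear α v)) lift ,
      λ α∷a'≡0 → cong₂ _∷_ (∷-injectiveˡ α∷a'≡0) (nonzero (∷-injectiveʳ α∷a'≡0))
      where open Linear
    orth′ : ∀ a y → (a ∷ y) ⟂ ((false ∷ v) ∷ bs) → y ⟂ (v ∷ R) × a ≡ dot y u
    orth′ a y (⟂v ∷ ⟂bs) with orth a y ⟂bs
    ... | ⟂R , a≡yu = (subst (_≡ false) (dot-zero-head a y v) ⟂v ∷ ⟂R) , a≡yu

module OrthogonalCount where
  open F₂Vectors
  open Counting
  open Elimination
  open import Data.Bool using (Bool; true; false; not)
  open import Data.Nat using (ℕ; zero; suc; _+_; _∸_; _≤_; _≤?_; z≤n; s≤s; s≤s⁻¹)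
  open import Data.Nat.Properties
    using (≤-refl; ≤-trans; ≤-reflexive; n≤1+n; m≤n⇒m≤1+n; +-comm; +-suc; +-mono-≤; +-monoʳ-≤; +-∸-assoc;
           module ≤-Reasoning)
  open import Data.Vec using (Vec; []; _∷_; map)
  open import Data.Vec.Relation.Unary.All using (all?)
  import Data.Bool as Bool
  open import Data.List.Properties using (length-filter)
  open import Data.Product using (_×_; _,_; proj₁; proj₂)
  open import Data.Empty using (⊥)
  open import Relation.Nullary using (Dec; _×-dec_)
  open import Relation.Unary using (Decidable)
  open import Relation.Binary.PropositionalEquality using (_≡_; refl; sym; trans; cong; subst)

  private
    variable
      n k : ℕ

  -- ball m t is the number of vectors of F₂ᵐ with at most t ones, i.e. Σ_{i ≤ t} (m choose i),
  -- computed by Pascal's rule on the first coordinate.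
  ball : ℕ → ℕ → ℕ
  ball m       zero    = 1
  ball zero    (suc t) = 1
  ball (suc m) (suc t) = ball m (suc t) + ball m t

  ball-zero-dim : ∀ t → ball 0 t ≡ 1
  ball-zero-dim zero    = refl
  ball-zero-dim (suc t) = refl

  zeros : F2^ n → ℕ
  zeros []          = 0
  zeros (true ∷ y)  = zeros y
  zeros (false ∷ y) = suc (zeros y)

  occ : Bool → F2^ n → ℕ
  occ true  = weight
  occ false = zeros

  occ-hit : ∀ p (y : F2^ n) → occ p (p ∷ y) ≡ suc (occ p y)
  occ-hit true  y = refl
  occ-hit false y = refl

  occ-miss : ∀ p (y : F2^ n) → occ p (not p ∷ y) ≡ occ p y
  occ-miss true  y = refl
  occ-miss false y = refl

  occ-tail : ∀ p a (y : F2^ n) → occ p y ≤ occ p (a ∷ y)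
  occ-tail true  true  y = n≤1+n _
  occ-tail true  false y = ≤-refl
  occ-tail false true  y = ≤-refl
  occ-tail false false y = n≤1+n _

  zeros+weight : (y : F2^ n) → zeros y + weight {n} y ≡ n
  zeros+weight []          = refl
  zeros+weight (true ∷ y)  = trans (+-suc (zeros y) (weight y)) (cong suc (zeros+weight y))
  zeros+weight (false ∷ y) = cong suc (zeros+weight y)

  _⟂?_ : (y : F2^ n) (b : Vec (F2^ n) k) → Dec (y ⟂ b)
  y ⟂? b = all? (λ v → dot y v Bool.≟ false) b

  Sparse⟂ : Bool → Vec (F2^ n) k → ℕ → F2^ n → Set
  Sparse⟂ p b t y = y ⟂ b × occ p y ≤ t

  sparse⟂? : ∀ p (b : Vec (F2^ n) k) t → Decidable (Sparse⟂ p b t)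
  sparse⟂? p b t y = (y ⟂? b) ×-dec (occ p y ≤? t)

  orthCount : Bool → Vec (F2^ n) k → ℕ → ℕ
  orthCount p b t = #⟨ sparse⟂? p b t ⟩

  #-split-at : ∀ p {ℓ} {P : F2^ (suc n) → Set ℓ} (P? : Decidable P) →
               #⟨ P? ⟩ ≡ #⟨ (λ y → P? (p ∷ y)) ⟩ + #⟨ (λ y → P? (not p ∷ y)) ⟩
  #-split-at false P? = #-split P?
  #-split-at true  P? = trans (#-split P?) (+-comm #⟨ (λ y → P? (false ∷ y)) ⟩ #⟨ (λ y → P? (true ∷ y)) ⟩)

  -- Zero first column: a vector (a, y') ⟂ b has y' ⟂ T, and occ p y' is one less than occ p (a, y')
  -- when a = p and the same when a = ¬p.  Counting both kinds is Pascal's rule for ball.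
  zero-column-bound : ∀ {m} (T : Vec (F2^ n) k) → (∀ p t → orthCount p T t ≤ ball m t) →
                      ∀ p t → orthCount p (map (false ∷_) T) t ≤ ball (suc m) t
  zero-column-bound {n} {m = m} T bound p t = begin
    orthCount p T′ t                   ≡⟨ #-split-at p (sparse⟂? p T′ t) ⟩
    #⟨ hit? t ⟩ + #⟨ miss? ⟩           ≤⟨ +-monoʳ-≤ #⟨ hit? t ⟩ (≤-trans (#-mono miss? (sparse⟂? p T t) miss) (bound p t)) ⟩
    #⟨ hit? t ⟩ + ball m t             ≤⟨ with-hits t ⟩
    ball (suc m) t                     ∎
    where
    open ≤-Reasoning
    T′ = map (false ∷_) T
    hit? : ∀ t → Decidable (λ y → Sparse⟂ p T′ t (p ∷ y))
    hit? t y = sparse⟂? p T′ t (p ∷ y)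
    miss? : Decidable (λ y → Sparse⟂ p T′ t (not p ∷ y))
    miss? y = sparse⟂? p T′ t (not p ∷ y)
    miss : ∀ {y} → Sparse⟂ p T′ t (not p ∷ y) → Sparse⟂ p T t y
    miss {y} (⟂T′ , occ≤t) = zero-column-⟂ (not p) y T ⟂T′ , subst (_≤ t) (occ-miss p y) occ≤t
    hit : ∀ {t y} → Sparse⟂ p T′ (suc t) (p ∷ y) → Sparse⟂ p T t y
    hit {t} {y} (⟂T′ , occ≤t) = zero-column-⟂ p y T ⟂T′ , s≤s⁻¹ (subst (_≤ suc t) (occ-hit p y) occ≤t)
    no-hit : ∀ {y} → Sparse⟂ p T′ 0 (p ∷ y) → ⊥
    no-hit {y} (_ , occ≤0) with subst (_≤ 0) (occ-hit p y) occ≤0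
    ... | ()
    with-hits : ∀ t → #⟨ hit? t ⟩ + ball m t ≤ ball (suc m) t
    with-hits zero    = ≤-reflexive (cong (_+ 1) (#-none (hit? 0) no-hit))
    with-hits (suc t) = begin
      #⟨ hit? (suc t) ⟩ + ball m (suc t)  ≤⟨ +-mono-≤ (≤-trans (#-mono (hit? (suc t)) (sparse⟂? p T t) hit) (bound p t)) ≤-refl ⟩
      ball m t + ball m (suc t)          ≡⟨ +-comm (ball m t) (ball m (suc t)) ⟩
      ball (suc m) (suc t)               ∎

  -- Pivot: y ↦ tail y is injective on {y ⟂ b}, since the first coordinate is forced to be dot (tail y) u,
  -- and maps it into {y' ⟂ R} without increasing occ p.
  pivot-bound : {b : Vec (F2^ (suc n)) (suc k)} (u : F2^ n) (R : Vec (F2^ n) k) →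
                (∀ a y → (a ∷ y) ⟂ b → y ⟂ R × a ≡ dot y u) → ∀ p t → orthCount p b t ≤ orthCount p R t
  pivot-bound {b = b} u R orth p t = begin
    orthCount p b t                                           ≡⟨ #-split (sparse⟂? p b t) ⟩
    #⟨ with-head? false ⟩ + #⟨ with-head? true ⟩              ≤⟨ #-disjoint (with-head? false) (with-head? true)
                                                                    (sparse⟂? p R t) (tail false) (tail true) disjoint ⟩
    orthCount p R t                                           ∎
    where
    open ≤-Reasoning
    with-head? : ∀ a → Decidable (λ y → Sparse⟂ p b t (a ∷ y))
    with-head? a y = sparse⟂? p b t (a ∷ y)
    tail : ∀ a {y} → Sparse⟂ p b t (a ∷ y) → Sparse⟂ p R t y
    tail a {y} (⟂b , occ≤t) = proj₁ (orth a y ⟂b) , ≤-trans (occ-tail p a y) occ≤t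
    disjoint : ∀ {y} → Sparse⟂ p b t (false ∷ y) → Sparse⟂ p b t (true ∷ y) → ⊥
    disjoint {y} (⟂b₀ , _) (⟂b₁ , _) with trans (proj₂ (orth false y ⟂b₀)) (sym (proj₂ (orth true y ⟂b₁)))
    ... | ()

  -- F₂⁰ has one element, so no nonempty family in it is independent.
  F2^0-trivial : (x : F2^ 0) → x ≡ []
  F2^0-trivial [] = refl

  orthCount-bound : ∀ n {k} (b : Vec (F2^ n) k) → LinIndep b →
                    k ≤ n × (∀ p t → orthCount p b t ≤ ball (n ∸ k) t)
  orthCount-bound zero    []      _     =
    z≤n , λ p t → ≤-trans (length-filter (sparse⟂? p [] t) _) (≤-reflexive (sym (ball-zero-dim t)))
  orthCount-bound zero    (v ∷ b) indep with indep (true ∷ zeroV) (F2^0-trivial _)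
  ... | ()
  orthCount-bound (suc n) b indep with firstColumn b
  ... | zero-column T with orthCount-bound n T (zero-column-indep T indep)
  ...   | k≤n , bound = m≤n⇒m≤1+n k≤n , λ p t →
            subst (λ d → orthCount p b t ≤ ball d t) (sym (+-∸-assoc 1 k≤n)) (zero-column-bound T bound p t)
  orthCount-bound (suc n) b indep | pivot u R lifts orth with orthCount-bound n R (lifts-indep lifts indep)
  ...   | k≤n , bound = s≤s k≤n , λ p t → ≤-trans (pivot-bound u R orth p t) (bound p t)

module PerpCount where
  open F₂Vectors
  open Counting
  open Elimination
  open OrthogonalCount
  open import Data.Bool using (true; false)
  open import Data.Nat using (ℕ; suc; _+_; _∸_; _≤_)
  open import Data.Nat.Properties using (≤-reflexive; +-cancelʳ-≤; m≤n+m∸n; module ≤-Reasoning)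
  open import Data.Vec using (Vec; []; _∷_)
  open import Data.Vec.Relation.Unary.All using ([]; _∷_)
  open import Data.List using (List; []; _∷_)
  open import Data.List.Membership.Propositional using (_∈_)
  open import Data.List.Membership.Propositional.Properties using (∈-map⁺; ∈-concatMap⁺)
  open import Data.List.Relation.Unary.Any using (here; there)
  import Data.List.Relation.Unary.Any as Any
  import Data.List.Relation.Unary.All as ListAll
  open import Data.Product using (_,_)
  open import Relation.Binary.PropositionalEquality using (_≡_; refl; sym; cong; subst)

  private
    variable
      n k : ℕ

  allVecs-complete : (x : F2^ n) → x ∈ allVecs n
  allVecs-complete []      = here refl
  allVecs-complete (a ∷ x) =
    ∈-concatMap⁺ both-heads (Any.map (λ { refl → first-coordinate a }) (allVecs-complete x))
    where
    both-heads : F2^ _ → List (F2^ (suc _))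
    both-heads x = (false ∷ x) ∷ (true ∷ x) ∷ []
    first-coordinate : ∀ a → (a ∷ x) ∈ both-heads x
    first-coordinate false = here refl
    first-coordinate true  = there (here refl)

  combinations⟂ : ∀ y (b : Vec (F2^ n) k) → (∀ a → dot y (lincomb a b) ≡ false) → y ⟂ b
  combinations⟂ y []      _       = []
  combinations⟂ y (v ∷ b) all⟂ =
    subst (λ x → dot y x ≡ false) (lincomb-unit v b) (all⟂ (true ∷ zeroV)) ∷
    combinations⟂ y b (λ a → subst (λ x → dot y x ≡ false) (lincomb-skip v a b) (all⟂ (false ∷ a)))

  perp⇒⟂ : ∀ y (b : Vec (F2^ n) k) → InPerp (span b) y → y ⟂ b
  perp⇒⟂ y b y∈V⟂ =
    combinations⟂ y b (λ a → ListAll.lookup y∈V⟂ (∈-map⁺ (λ a → lincomb a b) (allVecs-complete a)))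

  perp-weight-count : (b : Vec (F2^ n) k) (t : ℕ) → perpWeightCount (span b) t ≤ orthCount true b t
  perp-weight-count b t =
    #-mono _ (sparse⟂? true b t) (λ {y} (y∈V⟂ , weight≡t) → perp⇒⟂ y b y∈V⟂ , ≤-reflexive weight≡t)

  perp-coweight-count : (b : Vec (F2^ n) k) (t : ℕ) → perpWeightCount (span b) (n ∸ t) ≤ orthCount false b t
  perp-coweight-count {n} b t =
    #-mono _ (sparse⟂? false b t) (λ {y} (y∈V⟂ , weight≡n-t) → perp⇒⟂ y b y∈V⟂ , few-zeros y weight≡n-t)
    where
    few-zeros : ∀ y → weight y ≡ n ∸ t → zeros y ≤ t
    few-zeros y weight≡n-t = +-cancelʳ-≤ (n ∸ t) (zeros y) t (begin
      zeros y + (n ∸ t)     ≡⟨ cong (zeros y +_) (sym weight≡n-t) ⟩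
      zeros y + weight y    ≡⟨ zeros+weight y ⟩
      n                     ≤⟨ m≤n+m∸n n t ⟩
      t + (n ∸ t)           ∎)
      where open ≤-Reasoning

module BinomialEstimate where
  open OrthogonalCount using (ball; orthCount; orthCount-bound)
  open import Data.Vec using (Vec)
  open import Data.Product using (proj₂)
  open import Data.Nat
  open import Data.Nat.Properties
  open import Data.Nat.Tactic.RingSolver using (solve-∀)
  open import Data.Sum using (inj₁; inj₂)
  open import Relation.Binary.PropositionalEquality using (_≡_; refl; sym; cong)

  ^-distribʳ-* : ∀ m n p → (m * n) ^ p ≡ m ^ p * n ^ p
  ^-distribʳ-* m n zero    = refl
  ^-distribʳ-* m n (suc p) = begin-equality
    m * n * (m * n) ^ p        ≡⟨ cong (m * n *_) (^-distribʳ-* m n p) ⟩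
    m * n * (m ^ p * n ^ p)    ≡⟨ swap m n (m ^ p) (n ^ p) ⟩
    m * m ^ p * (n * n ^ p)    ∎
    where
    open ≤-Reasoning
    swap : ∀ m n A B → m * n * (A * B) ≡ m * A * (n * B)
    swap = solve-∀

  bernoulli : ∀ s x y → x ^ suc s + suc s * y * x ^ s ≤ (x + y) ^ suc s
  bernoulli zero    x y = ≤-reflexive (base x y)
    where
    base : ∀ x y → x * 1 + 1 * y * 1 ≡ (x + y) * 1
    base = solve-∀
  bernoulli (suc s) x y = begin
    x ^ suc (suc s) + suc (suc s) * y * x ^ suc s                    ≤⟨ m≤m+n _ (y * (suc s * y * x ^ s)) ⟩
    x ^ suc (suc s) + suc (suc s) * y * x ^ suc s + y * (suc s * y * x ^ s)
                                                                     ≡⟨ expand x y s (x ^ s) ⟩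
    (x + y) * (x ^ suc s + suc s * y * x ^ s)                        ≤⟨ *-monoʳ-≤ (x + y) (bernoulli s x y) ⟩
    (x + y) ^ suc (suc s)                                            ∎
    where
    open ≤-Reasoning
    expand : ∀ x y s P → x * (x * P) + suc (suc s) * y * (x * P) + y * (suc s * y * P)
                       ≡ (x + y) * (x * P + suc s * y * P)
    expand = solve-∀

  -- (1 + 1/s)^(s+1) is non-increasing in s ≥ 1: clearing denominators,
  -- (s+2)^(s+2) · s^(s+1) ≤ (s+1)^(s+1) · (s+1)^(s+2).  Bernoulli with x = s(s+2), y = 1.
  ratio-power-antitone : ∀ s → (2 + s) ^ (2 + s) * s ^ (1 + s) ≤ (1 + s) ^ (1 + s) * (1 + s) ^ (2 + s)
  ratio-power-antitone s = *-cancelˡ-≤ (1 + s) (begin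
    (1 + s) * ((2 + s) ^ (2 + s) * S)            ≡⟨ collect s T S ⟩
    x * (S * T) + (2 + s) * 1 * (S * T)           ≡⟨ cong (λ P → x * P + (2 + s) * 1 * P) (sym (^-distribʳ-* s (2 + s) (1 + s))) ⟩
    x ^ (2 + s) + (2 + s) * 1 * x ^ (1 + s)       ≤⟨ bernoulli (1 + s) x 1 ⟩
    (x + 1) ^ (2 + s)                             ≡⟨ cong (_^ (2 + s)) (square s) ⟩
    ((1 + s) * (1 + s)) ^ (2 + s)                 ≡⟨ ^-distribʳ-* (1 + s) (1 + s) (2 + s) ⟩
    (1 + s) ^ (2 + s) * (1 + s) ^ (2 + s)         ≡⟨ *-assoc (1 + s) ((1 + s) ^ (1 + s)) ((1 + s) ^ (2 + s)) ⟩
    (1 + s) * ((1 + s) ^ (1 + s) * (1 + s) ^ (2 + s)) ∎)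
    where
    open ≤-Reasoning
    x = s * (2 + s)
    S = s ^ (1 + s)
    T = (2 + s) ^ (1 + s)
    collect : ∀ s T S → (1 + s) * ((2 + s) * T * S) ≡ s * (2 + s) * (S * T) + (2 + s) * 1 * (S * T)
    collect = solve-∀
    square : ∀ s → s * (2 + s) + 1 ≡ (1 + s) * (1 + s)
    square = solve-∀

  -- (1 + 1/a)^(a+1) ≤ 7/2 for a ≥ 2: true at a = 2 (54 ≤ 56) and propagated by antitonicity.
  euler-bound-from-two : ∀ s → 2 * (3 + s) ^ (3 + s) ≤ 7 * (2 + s) ^ (3 + s)
  euler-bound-from-two zero    = ≤ᵇ⇒≤ 54 56 _
  euler-bound-from-two (suc s) =
    *-cancelʳ-≤ (2 * (4 + s) ^ (4 + s)) (7 * (3 + s) ^ (4 + s)) ((2 + s) ^ (3 + s)) {{m^n≢0 (2 + s) (3 + s)}} (begin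
      2 * (4 + s) ^ (4 + s) * (2 + s) ^ (3 + s)          ≡⟨ *-assoc 2 ((4 + s) ^ (4 + s)) ((2 + s) ^ (3 + s)) ⟩
      2 * ((4 + s) ^ (4 + s) * (2 + s) ^ (3 + s))        ≤⟨ *-monoʳ-≤ 2 (ratio-power-antitone (2 + s)) ⟩
      2 * ((3 + s) ^ (3 + s) * (3 + s) ^ (4 + s))        ≡⟨ *-assoc 2 ((3 + s) ^ (3 + s)) ((3 + s) ^ (4 + s)) ⟨
      2 * (3 + s) ^ (3 + s) * (3 + s) ^ (4 + s)          ≤⟨ *-monoˡ-≤ ((3 + s) ^ (4 + s)) (euler-bound-from-two s) ⟩
      7 * (2 + s) ^ (3 + s) * (3 + s) ^ (4 + s)          ≡⟨ swap 7 ((2 + s) ^ (3 + s)) ((3 + s) ^ (4 + s)) ⟩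
      7 * (3 + s) ^ (4 + s) * (2 + s) ^ (3 + s)          ∎)
    where
    open ≤-Reasoning
    swap : ∀ a P Q → a * P * Q ≡ a * Q * P
    swap = solve-∀

  -- (1 + 1/s)^s ≤ 7/2 for every s, cleared of denominators.
  euler-bound : ∀ s → 2 * suc s ^ s ≤ 7 * s ^ s
  euler-bound zero          = ≤ᵇ⇒≤ 2 7 _
  euler-bound (suc zero)    = ≤ᵇ⇒≤ 4 7 _
  euler-bound (suc (suc s)) =
    *-cancelʳ-≤ (2 * (3 + s) ^ (2 + s)) (7 * (2 + s) ^ (2 + s)) (3 + s) (begin
      2 * (3 + s) ^ (2 + s) * (3 + s)        ≡⟨ shift 2 ((3 + s) ^ (2 + s)) (3 + s) ⟩
      2 * (3 + s) ^ (3 + s)                  ≤⟨ euler-bound-from-two s ⟩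
      7 * ((2 + s) * (2 + s) ^ (2 + s))      ≤⟨ *-monoʳ-≤ 7 (*-monoˡ-≤ ((2 + s) ^ (2 + s)) (n≤1+n (2 + s))) ⟩
      7 * ((3 + s) * (2 + s) ^ (2 + s))      ≡⟨ shift 7 ((2 + s) ^ (2 + s)) (3 + s) ⟨
      7 * (2 + s) ^ (2 + s) * (3 + s)        ∎)
    where
    open ≤-Reasoning
    shift : ∀ a P q → a * P * q ≡ a * (q * P)
    shift = solve-∀

  ball≤2^ : ∀ m t → ball m t ≤ 2 ^ m
  ball≤2^ m       zero    = ^-monoʳ-≤ 2 {0} {m} z≤n
  ball≤2^ zero    (suc t) = ≤-refl
  ball≤2^ (suc m) (suc t) = begin
    ball m (suc t) + ball m t  ≤⟨ +-mono-≤ (ball≤2^ m (suc t)) (ball≤2^ m t) ⟩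
    2 ^ m + 2 ^ m              ≡⟨ cong (2 ^ m +_) (+-identityʳ (2 ^ m)) ⟨
    2 * 2 ^ m                  ∎
    where open ≤-Reasoning

  -- The binomial estimate Σ_{i ≤ t} (c choose i) ≤ (7c / 2t)^t for t ≤ c, cleared of denominators.
  -- Induction on c via Pascal's rule; the two terms recombine by Bernoulli, using (1 + 1/s)^s ≤ 7/2.
  ball-estimate : ∀ c t → t ≤ c → ball c t * (2 * t) ^ t ≤ (7 * c) ^ t
  ball-estimate c       zero    _         = ≤-refl
  ball-estimate (suc c) (suc s) (s≤s s≤c) with m≤n⇒m<n∨m≡n s≤c
  ... | inj₂ refl = begin
    ball t t * (2 * t) ^ t   ≤⟨ *-monoˡ-≤ ((2 * t) ^ t) (ball≤2^ t t) ⟩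
    2 ^ t * (2 * t) ^ t      ≡⟨ ^-distribʳ-* 2 (2 * t) t ⟨
    (2 * (2 * t)) ^ t        ≡⟨ cong (_^ t) (*-assoc 2 2 t) ⟨
    (4 * t) ^ t              ≤⟨ ^-monoˡ-≤ t (*-monoˡ-≤ t (≤ᵇ⇒≤ 4 7 _)) ⟩
    (7 * t) ^ t              ∎
    where
    open ≤-Reasoning
    t = suc s
  ... | inj₁ s<c = begin
    (ball c t + ball c s) * (2 * t) ^ t                   ≡⟨ *-distribʳ-+ ((2 * t) ^ t) (ball c t) (ball c s) ⟩
    ball c t * (2 * t) ^ t + ball c s * (2 * t) ^ t       ≤⟨ +-mono-≤ (ball-estimate c t s<c) (lower-term (ball c s)) ⟩
    (7 * c) ^ t + t * 7 * (ball c s * (2 * s) ^ s)        ≤⟨ +-monoʳ-≤ ((7 * c) ^ t) (*-monoʳ-≤ (t * 7) (ball-estimate c s (≤-trans (n≤1+n s) s<c))) ⟩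
    (7 * c) ^ t + t * 7 * (7 * c) ^ s                     ≤⟨ bernoulli s (7 * c) 7 ⟩
    (7 * c + 7) ^ t                                       ≡⟨ cong (_^ t) (+-comm (7 * c) 7) ⟩
    (7 + 7 * c) ^ t                                       ≡⟨ cong (_^ t) (*-suc 7 c) ⟨
    (7 * suc c) ^ t                                       ∎
    where
    open ≤-Reasoning
    t = suc s
    lower-term : ∀ B → B * (2 * t) ^ t ≤ t * 7 * (B * (2 * s) ^ s)
    lower-term B = begin
      B * (2 * t * (2 * t) ^ s)                 ≡⟨ cong (λ P → B * (2 * t * P)) (^-distribʳ-* 2 t s) ⟩
      B * (2 * t * (2 ^ s * t ^ s))             ≡⟨ regroup t B (2 ^ s) (t ^ s) ⟩
      t * 2 ^ s * B * (2 * t ^ s)               ≤⟨ *-monoʳ-≤ (t * 2 ^ s * B) (euler-bound s) ⟩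
      t * 2 ^ s * B * (7 * s ^ s)               ≡⟨ regroup′ t B (2 ^ s) (s ^ s) ⟩
      t * 7 * (B * (2 ^ s * s ^ s))             ≡⟨ cong (λ P → t * 7 * (B * P)) (^-distribʳ-* 2 s s) ⟨
      t * 7 * (B * (2 * s) ^ s)                 ∎
      where
      regroup : ∀ t B E F → B * (2 * t * (E * F)) ≡ t * E * B * (2 * F)
      regroup = solve-∀
      regroup′ : ∀ t B E G → t * E * B * (7 * G) ≡ t * 7 * (B * (E * G))
      regroup′ = solve-∀

  orthCount-estimate : ∀ n {k} (b : Vec (F2^ n) k) → LinIndep b → ∀ {t} → t ≤ n ∸ k →
                       ∀ p X → X ≤ orthCount p b t → X * (2 * t) ^ t ≤ (7 * (n ∸ k)) ^ t
  orthCount-estimate n {k} b indep {t} t≤c p X X≤count = begin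
    X * (2 * t) ^ t               ≤⟨ *-monoˡ-≤ ((2 * t) ^ t) (≤-trans X≤count (proj₂ (orthCount-bound n b indep) p t)) ⟩
    ball (n ∸ k) t * (2 * t) ^ t  ≤⟨ ball-estimate (n ∸ k) t t≤c ⟩
    (7 * (n ∸ k)) ^ t             ∎
    where open ≤-Reasoning

module RationalBounds where
  open import Data.Nat as ℕ using (ℕ; zero; suc)
  import Data.Nat.Properties as ℕ
  import Data.Nat.Coprimality as Coprime
  import Data.Integer as ℤ
  import Data.Integer.Properties as ℤ
  open import Data.Rational
    using (ℚ; mkℚ; _/_; _+_; _*_; _≤_; _<_; *≤*; 0ℚ; 1ℚ; ½; Positive; nonNegative; _≤?_; _<?_)
  open import Data.Rational.Properties
  open import Data.Rational.Solver using (module +-*-Solver)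
  open import Data.Product using (_,_)
  open import Data.Unit using (tt)
  open import Data.Empty using (⊥-elim)
  open import Relation.Nullary using (yes; no)
  open import Relation.Nullary.Decidable using (toWitness)
  open import Relation.Binary.PropositionalEquality using (_≡_; refl; sym; trans; cong; cong₂; subst; subst₂)
  open +-*-Solver using (solve; _:+_; _:*_; _:=_; con)

  fromℕ-mkℚ : ∀ m → fromℕ m ≡ mkℚ (ℤ.+ m) 0 (Coprime.sym (Coprime.1-coprimeTo m))
  fromℕ-mkℚ m = normalize-coprime (Coprime.sym (Coprime.1-coprimeTo m))

  fromℕ-+ : ∀ a b → fromℕ (a ℕ.+ b) ≡ fromℕ a + fromℕ b
  fromℕ-+ a b rewrite fromℕ-mkℚ a | fromℕ-mkℚ b =
    cong (_/ 1) (trans (ℤ.pos-+ a b) (sym (cong₂ ℤ._+_ (ℤ.*-identityʳ (ℤ.+ a)) (ℤ.*-identityʳ (ℤ.+ b)))))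

  fromℕ-* : ∀ a b → fromℕ (a ℕ.* b) ≡ fromℕ a * fromℕ b
  fromℕ-* a b rewrite fromℕ-mkℚ a | fromℕ-mkℚ b = cong (_/ 1) (ℤ.pos-* a b)

  fromℕ-mono : ∀ {a b} → a ℕ.≤ b → fromℕ a ≤ fromℕ b
  fromℕ-mono {a} {b} a≤b rewrite fromℕ-mkℚ a | fromℕ-mkℚ b =
    *≤* (subst₂ ℤ._≤_ (sym (ℤ.*-identityʳ (ℤ.+ a))) (sym (ℤ.*-identityʳ (ℤ.+ b))) (ℤ.+≤+ a≤b))

  fromℕ-nonNeg : ∀ a → 0ℚ ≤ fromℕ a
  fromℕ-nonNeg a = fromℕ-mono {0} {a} ℕ.z≤n

  fromℕ-^ : ∀ a n → fromℕ (a ℕ.^ n) ≡ fromℕ a ^ℚ n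
  fromℕ-^ a zero    = refl
  fromℕ-^ a (suc n) = trans (fromℕ-* a (a ℕ.^ n)) (cong (fromℕ a *_) (fromℕ-^ a n))

  fromℕ-pos : ∀ m → Positive (fromℕ (suc m))
  fromℕ-pos m = subst Positive (sym (fromℕ-mkℚ (suc m))) _

  invℕ-mkℚ : ∀ t → invℕ (suc t) ≡ mkℚ (ℤ.+ 1) t (Coprime.1-coprimeTo (suc t))
  invℕ-mkℚ t = normalize-coprime (Coprime.1-coprimeTo (suc t))

  fromℕ*invℕ : ∀ t → fromℕ (suc t) * invℕ (suc t) ≡ 1ℚ
  fromℕ*invℕ t rewrite fromℕ-mkℚ (suc t) | invℕ-mkℚ t =
    *-inverseʳ (mkℚ (ℤ.+ suc t) 0 (Coprime.sym (Coprime.1-coprimeTo (suc t))))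

  invℕ-nonNeg : ∀ t → 0ℚ ≤ invℕ t
  invℕ-nonNeg zero    = ≤-refl
  invℕ-nonNeg (suc t) rewrite invℕ-mkℚ t = *≤* (ℤ.+≤+ ℕ.z≤n)

  invℕ≤1 : ∀ t → invℕ (suc t) ≤ 1ℚ
  invℕ≤1 t rewrite invℕ-mkℚ t = *≤* (ℤ.+≤+ (ℕ.s≤s ℕ.z≤n))

  ^ℚ-nonNeg : ∀ {a} → 0ℚ ≤ a → ∀ n → 0ℚ ≤ a ^ℚ n
  ^ℚ-nonNeg a≥0 zero    = toWitness {a? = 0ℚ ≤? 1ℚ} tt
  ^ℚ-nonNeg {a} a≥0 (suc n) =
    nonNegative⁻¹ _ {{nonNeg*nonNeg⇒nonNeg a {{nonNegative a≥0}} (a ^ℚ n) {{nonNegative (^ℚ-nonNeg a≥0 n)}}}}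

  ^ℚ-monoˡ : ∀ {a b} → 0ℚ ≤ a → a ≤ b → ∀ n → a ^ℚ n ≤ b ^ℚ n
  ^ℚ-monoˡ a≥0 a≤b zero    = ≤-refl
  ^ℚ-monoˡ {a} {b} a≥0 a≤b (suc n) =
    ≤-trans (*-monoˡ-≤-nonNeg a {{nonNegative a≥0}} (^ℚ-monoˡ a≥0 a≤b n))
            (*-monoʳ-≤-nonNeg (b ^ℚ n) {{nonNegative (^ℚ-nonNeg (≤-trans a≥0 a≤b) n)}} a≤b)

  ^ℚ-distrib-* : ∀ a b n → (a * b) ^ℚ n ≡ a ^ℚ n * b ^ℚ n
  ^ℚ-distrib-* a b zero    = refl
  ^ℚ-distrib-* a b (suc n) = trans (cong ((a * b) *_) (^ℚ-distrib-* a b n)) (interchange a b (a ^ℚ n) (b ^ℚ n))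
    where
    interchange : ∀ a b A B → (a * b) * (A * B) ≡ (a * A) * (b * B)
    interchange = solve 4 (λ a b A B → (a :* b) :* (A :* B) := (a :* A) :* (b :* B)) refl

  p≤p+q : ∀ p q → 0ℚ ≤ q → p ≤ p + q
  p≤p+q p q q≥0 = subst (_≤ p + q) (+-identityʳ p) (+-monoʳ-≤ p q≥0)

  fromℕ-pos′ : ∀ {m} → 0 ℕ.< m → Positive (fromℕ m)
  fromℕ-pos′ {suc m} _ = fromℕ-pos m

  -- κ = 2·(1 + 1 + 1/2 + 1/6)·(1/2 + 1/8 + 1/24) = 32/9 is the value at N = 3 of the sequence
  -- 2·eSeq N·lnTwo N increasing to 2e ln 2; all we use is 7/2 ≤ κ.
  κ : ℚ
  κ = fromℕ 2 * eSeq 3 * lnTwo 3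

  seven≤2κ : fromℕ 7 ≤ fromℕ 2 * κ
  seven≤2κ = toWitness {a? = fromℕ 7 ≤? (fromℕ 2 * κ)} tt

  scaled-bound : ∀ X c t → X ℕ.* (2 ℕ.* suc t) ℕ.^ suc t ℕ.≤ (7 ℕ.* c) ℕ.^ suc t →
                 fromℕ X ≤ (κ * fromℕ c * invℕ (suc t)) ^ℚ suc t
  scaled-bound X c t′ X·P≤Q = *-cancelˡ-≤-pos (F P) {{fromℕ-pos′ (ℕ.m^n>0 (2 ℕ.* t) t)}} (begin
    F P * F X                  ≡⟨ fromℕ-* P X ⟨
    F (P ℕ.* X)                ≤⟨ fromℕ-mono (subst (ℕ._≤ (7 ℕ.* c) ℕ.^ t) (ℕ.*-comm X P) X·P≤Q) ⟩
    F ((7 ℕ.* c) ℕ.^ t)        ≡⟨ fromℕ-power 7 c ⟩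
    (F 7 * F c) ^ℚ t           ≤⟨ ^ℚ-monoˡ 7c≥0 7c≤2tr t ⟩
    (F 2 * F t * r) ^ℚ t       ≡⟨ ^ℚ-distrib-* (F 2 * F t) r t ⟩
    (F 2 * F t) ^ℚ t * r ^ℚ t  ≡⟨ cong (_* r ^ℚ t) (fromℕ-power 2 t) ⟨
    F P * r ^ℚ t               ∎)
    where
    open ≤-Reasoning
    F = fromℕ
    t = suc t′
    P = (2 ℕ.* t) ℕ.^ t
    r = κ * F c * invℕ t
    fromℕ-power : ∀ a b → F ((a ℕ.* b) ℕ.^ t) ≡ (F a * F b) ^ℚ t
    fromℕ-power a b = trans (fromℕ-^ (a ℕ.* b) t) (cong (_^ℚ t) (fromℕ-* a b))
    7c≥0 : 0ℚ ≤ F 7 * F c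
    7c≥0 = subst (0ℚ ≤_) (fromℕ-* 7 c) (fromℕ-nonNeg (7 ℕ.* c))
    regroup : ∀ a b q c i → a * b * ((q * c) * i) ≡ (a * q) * c * (b * i)
    regroup = solve 5 (λ a b q c i → a :* b :* ((q :* c) :* i) := (a :* q) :* c :* (b :* i)) refl
    2tr≡2κc : F 2 * F t * r ≡ (F 2 * κ) * F c
    2tr≡2κc = trans (regroup (F 2) (F t) κ (F c) (invℕ t))
                    (trans (cong ((F 2 * κ) * F c *_) (fromℕ*invℕ t′)) (*-identityʳ _))
    7c≤2tr : F 7 * F c ≤ F 2 * F t * r
    7c≤2tr = subst (F 7 * F c ≤_) (sym 2tr≡2κc) (*-monoʳ-≤-nonNeg (F c) {{nonNegative (fromℕ-nonNeg c)}} seven≤2κ)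

  -- The partial sums of ln 2 = Σ 1/(k 2ᵏ) satisfy lnTwo N + 2⁻ᴺ ≤ 1, since 1/(k 2ᵏ) ≤ 2⁻ᵏ.
  lnTwo-partial : ∀ N → lnTwo N + ½ ^ℚ N ≤ 1ℚ
  lnTwo-partial zero    = toWitness {a? = 0ℚ + 1ℚ ≤? 1ℚ} tt
  lnTwo-partial (suc N) = begin
    (L + invℕ (suc N) * (½ * H)) + ½ * H  ≤⟨ +-monoˡ-≤ (½ * H) (+-monoʳ-≤ L
                                               (*-monoʳ-≤-nonNeg (½ * H) {{nonNegative ½H≥0}} (invℕ≤1 N))) ⟩
    (L + 1ℚ * (½ * H)) + ½ * H            ≡⟨ halves L ½ H ⟩
    L + (½ + ½) * H                       ≡⟨ cong (L +_) (*-identityˡ H) ⟩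
    L + H                                 ≤⟨ lnTwo-partial N ⟩
    1ℚ                                    ∎
    where
    open ≤-Reasoning
    L = lnTwo N
    H = ½ ^ℚ N
    ½H≥0 : 0ℚ ≤ ½ * H
    ½H≥0 = ^ℚ-nonNeg (toWitness {a? = 0ℚ ≤? ½} tt) (suc N)
    halves : ∀ L h H → (L + 1ℚ * (h * H)) + h * H ≡ L + (h + h) * H
    halves = solve 3 (λ L h H → (L :+ con 1ℚ :* (h :* H)) :+ h :* H := L :+ (h :+ h) :* H) refl

  lnTwo≤1 : ∀ N → lnTwo N ≤ 1ℚ
  lnTwo≤1 N = ≤-trans (p≤p+q (lnTwo N) (½ ^ℚ N) (^ℚ-nonNeg (toWitness {a? = 0ℚ ≤? ½} tt) N)) (lnTwo-partial N)

  ≤-term⇒≤lim : ∀ {q} s N → q ≤ s N → q ≤lim s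
  ≤-term⇒≤lim s N q≤sN m = N , ≤-trans q≤sN (p≤p+q (s N) (invℕ (suc m)) (invℕ-nonNeg (suc m)))

  -- Since ln 2 ≤ 1, the hypothesis t ≤ c·ln 2 of the theorem forces t ≤ c.
  ≤lim-ln2⇒≤ : ∀ t c → fromℕ t ≤lim (λ N → fromℕ c * lnTwo N) → t ℕ.≤ c
  ≤lim-ln2⇒≤ t c t≤c·ln2 with t ℕ.≤? c | t≤c·ln2 1
  ... | yes t≤c | _       = t≤c
  ... | no  t≰c | N , t≤ = contradiction (≤-<-trans c+1≤c+½ (+-monoʳ-< (F c) (toWitness {a? = invℕ 2 <? 1ℚ} tt)))
    where
    open ≤-Reasoning
    F = fromℕ
    c+1≤c+½ : F c + 1ℚ ≤ F c + invℕ 2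
    c+1≤c+½ = begin
      F c + 1ℚ                 ≡⟨ fromℕ-+ c 1 ⟨
      F (c ℕ.+ 1)              ≤⟨ fromℕ-mono (subst (ℕ._≤ t) (ℕ.+-comm 1 c) (ℕ.≰⇒> t≰c)) ⟩
      F t                      ≤⟨ t≤ ⟩
      F c * lnTwo N + invℕ 2   ≤⟨ +-monoˡ-≤ (invℕ 2) (subst (F c * lnTwo N ≤_) (*-identityʳ (F c))
                                    (*-monoˡ-≤-nonNeg (F c) {{nonNegative (fromℕ-nonNeg c)}} (lnTwo≤1 N))) ⟩
      F c + invℕ 2             ∎
    contradiction : F c + 1ℚ < F c + 1ℚ → t ℕ.≤ c
    contradiction c+1<c+1 = ⊥-elim (<-irrefl refl c+1<c+1)

open import Data.Nat using (ℕ; zero; suc; _≤_; _∸_)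
open import Data.Vec using (Vec)
open import Data.Rational using (ℚ; _*_)
open import Data.Product using (_×_; _,_)
open import Data.Bool using (true; false)
open PerpCount using (perp-weight-count; perp-coweight-count)
open BinomialEstimate using (orthCount-estimate)
open RationalBounds using (scaled-bound; ≤-term⇒≤lim; ≤lim-ln2⇒≤)

corollary4p4 : (n k : ℕ) (b : Vec (F2^ n) k) → LinIndep b →
    let c = n ∸ k in
    (t : ℕ) → 1 ≤ t → fromℕ t ≤lim (λ N → fromℕ c * lnTwo N) →
      (fromℕ (perpWeightCount (span b) t)
          ≤lim (λ N → (fromℕ 2 * eSeq N * lnTwo N * fromℕ c * invℕ t) ^ℚ t))
      × (fromℕ (perpWeightCount (span b) (n ∸ t))
          ≤lim (λ N → (fromℕ 2 * eSeq N * lnTwo N * fromℕ c * invℕ t) ^ℚ t))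
corollary4p4 n k b indep zero    () _
corollary4p4 n k b indep (suc t) _  t≤c·ln2 =
    ≤-term⇒≤lim bound 3 (scaled-bound weight-t c t
      (orthCount-estimate n b indep t≤c true weight-t (perp-weight-count b (suc t)))) ,
    ≤-term⇒≤lim bound 3 (scaled-bound weight-n-t c t
      (orthCount-estimate n b indep t≤c false weight-n-t (perp-coweight-count b (suc t))))
  where
  c : ℕ
  c = n ∸ k
  t≤c : suc t ≤ c
  t≤c = ≤lim-ln2⇒≤ (suc t) c t≤c·ln2
  -- the bound of the statement; its term N = 3 is (κ c / t)^t
  bound : ℕ → ℚ
  bound N = (fromℕ 2 * eSeq N * lnTwo N * fromℕ c * invℕ (suc t)) ^ℚ suc t
  weight-t weight-n-t : ℕ
  weight-t   = perpWeightCount (span b) (suc t)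
  weight-n-t = perpWeightCount (span b) (n ∸ suc t)
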